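{- The stuffle product $*$ makes $\mathfrak{A}^1$ a commutative graded $\mathbb{Q}$-algebra (with unit $\mathbf{1}$, graded by weight).
   Context: Fix an integer $N\ge1$; indices of letters are read modulo $N$. Let $\mathfrak{A}=\mathbb{Q}\langle a,b_0,\dots,b_{N-1}\rangle$ be the free noncommutative $\mathbb{Q}$-algebra (unit = empty word $\mathbf{1}$), graded by weight = number of letters. For $s\ge1$ put $y_{s,i}=a^{s-1}b_i$, and let $\mathfrak{A}^1$ be the span of words not ending in $a$ (the free algebra on the $y_{s,i}$). For an integer $j$, $\tau_j$ is the $\mathbb{Q}$-linear map on $\mathfrak{A}^1$ with $\tau_j(\mathbf{1})=\mathbf{1}$ and $\tau_j(y_{s_1,i_1}\cdots y_{s_n,i_n})=y_{s_1,i_1+j}\cdots y_{s_n,i_n+j}$. The stuffle product $*$ on $\mathfrak{A}^1$ is the $\mathbb{Q}$-bilinear product with $\mathbf{1}*w=w*\mathbf{1}=w$ and, for words $\omega_1,\omega_2$, $y_{s,j}\omega_1*y_{t,k}\omega_2=y_{s,j}\tau_j\big(\tau_{ -j}(\omega_1)*y_{t,k}\omega_2\big)+y_{t,k}\tau_k\big(y_{s,j}\omega_1*\tau_{ -k}(\omega_2)\big)+y_{s+t,j+k}\tau_{j+k}\big(\tau_{ -j}(\omega_1)*\tau_{ -k}(\omega_2)\big)$. -}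

module Defs where

open import Data.Nat as ℕ using (ℕ; zero; suc; NonZero; _∸_)
open import Data.Nat.DivMod using (_mod_)
open import Data.Fin as Fin using (Fin; toℕ)
import Data.Fin.Properties as FinP
import Data.Nat.Properties as ℕP
open import Data.Rational as ℚ using (ℚ; 0ℚ; 1ℚ)
open import Data.List using (List; []; _∷_; _++_; map; concatMap; length)
open import Data.Nat.ListAction using (sum)
import Data.List.Properties as ListP
open import Data.Product using (_×_; _,_; proj₁; proj₂)
import Data.Product.Properties as ProdP
open import Relation.Binary.PropositionalEquality using (_≡_)
open import Relation.Binary.Definitions using (DecidableEquality)
open import Relation.Nullary using (yes; no)
open import Algebra.Structures using (IsCommutativeRing)

module Stuffle (N : ℕ) .{{_ : NonZero N}} where

  -- Indices in ℤ/Nℤ, represented by Fin N, with addition and negation mod N.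
  Idx : Set
  Idx = Fin N

  _⊕_ : Idx → Idx → Idx
  i ⊕ j = (toℕ i ℕ.+ toℕ j) mod N

  ⊖_ : Idx → Idx
  ⊖ i = (N ∸ toℕ i) mod N

  -- A letter (e , i) stands for y_{e+1,i} = a^e b_i  (so s = e + 1 ≥ 1).
  Letter : Set
  Letter = ℕ × Idx

  letterWeight : Letter → ℕ
  letterWeight (e , _) = suc e

  -- words in the y_{s,i}: a basis of 𝔄¹ (the empty word is 𝟏)
  Word : Set
  Word = List Letter

  weight : Word → ℕ
  weight w = sum (map letterWeight w)

  _≟W_ : DecidableEquality Word
  _≟W_ = ListP.≡-dec (ProdP.≡-dec ℕP._≟_ FinP._≟_)

  τ : Idx → Word → Word
  τ j = map (λ { (e , i) → (e , i ⊕ j) })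

  -- Elements of 𝔄¹: finite formal ℚ-linear combinations of words,
  -- identified when all coefficients agree.
  Poly : Set
  Poly = List (ℚ × Word)

  coeff : Poly → Word → ℚ
  coeff [] w = 0ℚ
  coeff ((c , u) ∷ p) w with u ≟W w
  ... | yes _ = c ℚ.+ coeff p w
  ... | no _  = coeff p w

  _≈_ : Poly → Poly → Set
  p ≈ q = ∀ w → coeff p w ≡ coeff q w

  _+P_ : Poly → Poly → Poly
  p +P q = p ++ q

  _·P_ : ℚ → Poly → Poly
  c ·P p = map (λ { (d , u) → (c ℚ.* d , u) }) p

  -P_ : Poly → Poly
  -P p = (ℚ.- 1ℚ) ·P p

  0P : Poly
  0P = []

  word : Word → Poly
  word w = (1ℚ , w) ∷ []

  1P : Poly
  1P = word []

  τP : Idx → Poly → Poly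
  τP j = map (λ { (c , u) → (c , τ j u) })

  consP : Letter → Poly → Poly
  consP x = map (λ { (c , u) → (c , x ∷ u) })

  -- stuffle of two words, by the recursive definition; the first argument is
  -- fuel (always started at the total length, so it never runs out).
  stuffleF : ℕ → Word → Word → Poly
  stuffleF _ [] v = word v
  stuffleF _ (x ∷ u) [] = word (x ∷ u)
  stuffleF zero (_ ∷ _) (_ ∷ _) = []
  stuffleF (suc n) ((s , j) ∷ ω₁) ((t , k) ∷ ω₂) =
       consP (s , j) (τP j (stuffleF n (τ (⊖ j) ω₁) ((t , k) ∷ ω₂)))
    ++ consP (t , k) (τP k (stuffleF n ((s , j) ∷ ω₁) (τ (⊖ k) ω₂)))
    ++ consP (suc (s ℕ.+ t) , j ⊕ k)
             (τP (j ⊕ k) (stuffleF n (τ (⊖ j) ω₁) (τ (⊖ k) ω₂)))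
    -- y_{s+1,j}, y_{t+1,k} ↦ y_{(s+1)+(t+1), j+k}, i.e. exponent s+t+1

  stuffleW : Word → Word → Poly
  stuffleW u v = stuffleF (length u ℕ.+ length v) u v

  _*_ : Poly → Poly → Poly
  p * q = concatMap (λ { (c , u) →
            concatMap (λ { (d , v) → (c ℚ.* d) ·P stuffleW u v }) q }) p

  Homogeneous : ℕ → Poly → Set
  Homogeneous n p = ∀ w → (coeff p w ≡ 0ℚ → Data.Empty.⊥) → weight w ≡ n
    where import Data.Empty

  record IsCommGradedAlgebra : Set where
    field
      isCommutativeRing : IsCommutativeRing _≈_ _+P_ _*_ -P_ 0P 1P
      *-scalarˡ : ∀ c p q → ((c ·P p) * q) ≈ (c ·P (p * q))
      *-scalarʳ : ∀ c p q → (p * (c ·P q)) ≈ (c ·P (p * q))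
      *-graded : ∀ m n p q → Homogeneous m p → Homogeneous n q →
                 Homogeneous (m ℕ.+ n) (p * q)
      1-homogeneous : Homogeneous 0 1P

module Submission where

-- Products are handled through the pairing ⟪ F ∣ p ⟫ = Σ c_u F(u) of a formal sum p = Σ c_u u with an
-- arbitrary F : Word → ℚ. Two formal sums have the same coefficients iff all their pairings agree, and the
-- pairing of p * q is bilinear in p and q, so congruence, distributivity and the scalar laws are
-- immediate, and commutativity and associativity reduce to products of single words.
--
-- For a letter x = y_{s,j} write x ◃ p for x τ_j(p). The defining recursion of the stuffle product reads
--   (x ◃ p) * (y ◃ q) = x ◃ (p * (y ◃ q)) + y ◃ ((x ◃ p) * q) + (x ◇ y) ◃ (p * q),
-- where y_{s,j} ◇ y_{t,k} = y_{s+t,j+k} is commutative and associative. Every nonempty word is x ◃ u for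
-- a word u with one letter less, so on words commutativity and associativity follow by induction on the
-- number of letters, exactly as for Hoffman's quasi-shuffle products. Each of the three terms has the
-- weight of x ◃ p plus that of y ◃ q, which gives the grading.

open import Defs
open import Algebra.Bundles using (CommutativeMonoid)
import Algebra.Properties.CommutativeSemigroup as CommutativeSemigroupProperties
import Algebra.Properties.Group as GroupProperties
import Algebra.Properties.Ring as RingProperties
import Algebra.Solver.CommutativeMonoid as CommutativeMonoidSolver
open import Algebra.Structures using (IsCommutativeMonoid; IsCommutativeRing)
open import Data.Empty using (⊥-elim)
open import Data.Fin using (toℕ)
import Data.Fin.Properties as FinP
open import Data.List using (List; []; _∷_; _++_; concatMap; length)
import Data.List.Properties as ListP
open import Data.List.Relation.Unary.All using (All; []; _∷_)
open import Data.List.Relation.Unary.All.Properties using (++⁺)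
open import Data.Nat as ℕ using (ℕ; NonZero; zero; suc; _≤_; z≤n; s≤s; _∸_; _%_)
open import Data.Nat.DivMod using (_mod_; %-distribˡ-+; m%n%n≡m%n; [m+n]%n≡m%n; m<n⇒m%n≡m)
import Data.Nat.Properties as ℕP
open import Data.Nat.Tactic.RingSolver using (solve-∀)
open import Data.Product using (Σ; _,_; proj₂)
open import Data.Rational as ℚ using (ℚ; 0ℚ; 1ℚ)
import Data.Rational.Properties as ℚP
open import Data.Sum as Sum using (_⊎_; inj₁; inj₂)
open import Function using (_∘_; flip)
open import Level using (0ℓ)
open import Relation.Binary.Bundles using (Setoid)
open import Relation.Binary.PropositionalEquality
import Relation.Binary.Reasoning.Setoid as SetoidReasoning
open import Relation.Binary.Structures using (IsEquivalence)
open import Relation.Nullary using (yes; no; ¬_)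

module ℚ+ = CommutativeSemigroupProperties (CommutativeMonoid.commutativeSemigroup ℚP.+-0-commutativeMonoid)
module ℚ-group = GroupProperties ℚP.+-0-group
module ℚ-ring = RingProperties ℚP.+-*-ring

*-vanishes : ∀ a b → a ≡ 0ℚ ⊎ b ≡ 0ℚ → a ℚ.* b ≡ 0ℚ
*-vanishes a b (inj₁ refl) = ℚP.*-zeroˡ b
*-vanishes a b (inj₂ refl) = ℚP.*-zeroʳ a

module IndexShifts (N : ℕ) .{{_ : NonZero N}} where
  open Stuffle N
  open ≡-Reasoning

  toℕ-mod : ∀ m → toℕ (m mod N) ≡ m % N
  toℕ-mod m = FinP.toℕ-fromℕ< _

  mod-cong : ∀ {m n} → m % N ≡ n % N → m mod N ≡ n mod N
  mod-cong {m} {n} eq = FinP.toℕ-injective (begin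
    toℕ (m mod N)  ≡⟨ toℕ-mod m ⟩
    m % N          ≡⟨ eq ⟩
    n % N          ≡⟨ toℕ-mod n ⟨
    toℕ (n mod N)  ∎)

  mod-toℕ : ∀ (i : Idx) → toℕ i mod N ≡ i
  mod-toℕ i = FinP.toℕ-injective (trans (toℕ-mod (toℕ i)) (m<n⇒m%n≡m (FinP.toℕ<n i)))

  mod-⊕-mod : ∀ m n → (m mod N) ⊕ (n mod N) ≡ (m ℕ.+ n) mod N
  mod-⊕-mod m n = mod-cong (begin
    (toℕ (m mod N) ℕ.+ toℕ (n mod N)) % N
      ≡⟨ cong₂ (λ a b → (a ℕ.+ b) % N) (toℕ-mod m) (toℕ-mod n) ⟩
    (m % N ℕ.+ n % N) % N
      ≡⟨ cong₂ (λ a b → (a ℕ.+ b) % N) (m%n%n≡m%n m N) (m%n%n≡m%n n N) ⟨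
    (m % N % N ℕ.+ n % N % N) % N
      ≡⟨ %-distribˡ-+ (m % N) (n % N) N ⟨
    (m % N ℕ.+ n % N) % N
      ≡⟨ %-distribˡ-+ m n N ⟨
    (m ℕ.+ n) % N
      ∎)

  +N-mod : ∀ (i : Idx) → (toℕ i ℕ.+ N) mod N ≡ i
  +N-mod i = trans (mod-cong ([m+n]%n≡m%n (toℕ i) N)) (mod-toℕ i)

  ⊕-comm : ∀ i j → i ⊕ j ≡ j ⊕ i
  ⊕-comm i j = cong (_mod N) (ℕP.+-comm (toℕ i) (toℕ j))

  ⊕-assoc : ∀ i j k → (i ⊕ j) ⊕ k ≡ i ⊕ (j ⊕ k)
  ⊕-assoc i j k = begin
    (i ⊕ j) ⊕ k
      ≡⟨ cong ((i ⊕ j) ⊕_) (mod-toℕ k) ⟨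
    ((toℕ i ℕ.+ toℕ j) mod N) ⊕ (toℕ k mod N)
      ≡⟨ mod-⊕-mod (toℕ i ℕ.+ toℕ j) (toℕ k) ⟩
    (toℕ i ℕ.+ toℕ j ℕ.+ toℕ k) mod N
      ≡⟨ cong (_mod N) (ℕP.+-assoc (toℕ i) (toℕ j) (toℕ k)) ⟩
    (toℕ i ℕ.+ (toℕ j ℕ.+ toℕ k)) mod N
      ≡⟨ mod-⊕-mod (toℕ i) (toℕ j ℕ.+ toℕ k) ⟨
    (toℕ i mod N) ⊕ ((toℕ j ℕ.+ toℕ k) mod N)
      ≡⟨ cong (_⊕ (j ⊕ k)) (mod-toℕ i) ⟩
    i ⊕ (j ⊕ k)
      ∎

  ⊕-⊖-cancel : ∀ i j → (i ⊕ j) ⊕ (⊖ j) ≡ i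
  ⊕-⊖-cancel i j = begin
    (i ⊕ j) ⊕ (⊖ j)
      ≡⟨ mod-⊕-mod (toℕ i ℕ.+ toℕ j) (N ∸ toℕ j) ⟩
    (toℕ i ℕ.+ toℕ j ℕ.+ (N ∸ toℕ j)) mod N
      ≡⟨ cong (_mod N) (ℕP.+-assoc (toℕ i) (toℕ j) (N ∸ toℕ j)) ⟩
    (toℕ i ℕ.+ (toℕ j ℕ.+ (N ∸ toℕ j))) mod N
      ≡⟨ cong (λ m → (toℕ i ℕ.+ m) mod N) (ℕP.m+[n∸m]≡n (FinP.toℕ≤n j)) ⟩
    (toℕ i ℕ.+ N) mod N
      ≡⟨ +N-mod i ⟩
    i
      ∎

  ⊖-⊕-cancel : ∀ i j → (i ⊕ (⊖ j)) ⊕ j ≡ i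
  ⊖-⊕-cancel i j = begin
    (i ⊕ (⊖ j)) ⊕ j
      ≡⟨ cong₂ (λ a b → (a ⊕ (⊖ j)) ⊕ b) (mod-toℕ i) (mod-toℕ j) ⟨
    ((toℕ i mod N) ⊕ (⊖ j)) ⊕ (toℕ j mod N)
      ≡⟨ cong (_⊕ (toℕ j mod N)) (mod-⊕-mod (toℕ i) (N ∸ toℕ j)) ⟩
    ((toℕ i ℕ.+ (N ∸ toℕ j)) mod N) ⊕ (toℕ j mod N)
      ≡⟨ mod-⊕-mod (toℕ i ℕ.+ (N ∸ toℕ j)) (toℕ j) ⟩
    (toℕ i ℕ.+ (N ∸ toℕ j) ℕ.+ toℕ j) mod N
      ≡⟨ cong (_mod N) (ℕP.+-assoc (toℕ i) (N ∸ toℕ j) (toℕ j)) ⟩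
    (toℕ i ℕ.+ (N ∸ toℕ j ℕ.+ toℕ j)) mod N
      ≡⟨ cong (λ m → (toℕ i ℕ.+ m) mod N) (ℕP.m∸n+n≡m (FinP.toℕ≤n j)) ⟩
    (toℕ i ℕ.+ N) mod N
      ≡⟨ +N-mod i ⟩
    i
      ∎

  τ-⊖-τ : ∀ j u → τ (⊖ j) (τ j u) ≡ u
  τ-⊖-τ j [] = refl
  τ-⊖-τ j ((e , i) ∷ u) = cong₂ _∷_ (cong (e ,_) (⊕-⊖-cancel i j)) (τ-⊖-τ j u)

  τ-τ-⊖ : ∀ j u → τ j (τ (⊖ j) u) ≡ u
  τ-τ-⊖ j [] = refl
  τ-τ-⊖ j ((e , i) ∷ u) = cong₂ _∷_ (cong (e ,_) (⊖-⊕-cancel i j)) (τ-τ-⊖ j u)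

  length-τ : ∀ j u → length (τ j u) ≡ length u
  length-τ j [] = refl
  length-τ j (x ∷ u) = cong suc (length-τ j u)

  weight-τ : ∀ j u → weight (τ j u) ≡ weight u
  weight-τ j [] = refl
  weight-τ j ((e , i) ∷ u) = cong (suc e ℕ.+_) (weight-τ j u)

module Pairing (N : ℕ) .{{_ : NonZero N}} where
  open Stuffle N
  open ≡-Reasoning

  ⟪_∣_⟫ : (Word → ℚ) → Poly → ℚ
  ⟪ F ∣ [] ⟫ = 0ℚ
  ⟪ F ∣ (c , u) ∷ p ⟫ = c ℚ.* F u ℚ.+ ⟪ F ∣ p ⟫

  pairing-cong : ∀ {F G} p → (∀ u → F u ≡ G u) → ⟪ F ∣ p ⟫ ≡ ⟪ G ∣ p ⟫
  pairing-cong [] F≗G = refl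
  pairing-cong ((c , u) ∷ p) F≗G = cong₂ (λ a b → c ℚ.* a ℚ.+ b) (F≗G u) (pairing-cong p F≗G)

  pairing-++ : ∀ F p q → ⟪ F ∣ p ++ q ⟫ ≡ ⟪ F ∣ p ⟫ ℚ.+ ⟪ F ∣ q ⟫
  pairing-++ F [] q = sym (ℚP.+-identityˡ ⟪ F ∣ q ⟫)
  pairing-++ F ((c , u) ∷ p) q =
    trans (cong (c ℚ.* F u ℚ.+_) (pairing-++ F p q))
          (sym (ℚP.+-assoc (c ℚ.* F u) ⟪ F ∣ p ⟫ ⟪ F ∣ q ⟫))

  pairing-++₃ : ∀ F p q r →
                ⟪ F ∣ p ++ q ++ r ⟫ ≡ ⟪ F ∣ p ⟫ ℚ.+ (⟪ F ∣ q ⟫ ℚ.+ ⟪ F ∣ r ⟫)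
  pairing-++₃ F p q r = trans (pairing-++ F p (q ++ r)) (cong (⟪ F ∣ p ⟫ ℚ.+_) (pairing-++ F q r))

  pairing-·P : ∀ F c p → ⟪ F ∣ c ·P p ⟫ ≡ c ℚ.* ⟪ F ∣ p ⟫
  pairing-·P F c [] = sym (ℚP.*-zeroʳ c)
  pairing-·P F c ((d , u) ∷ p) = begin
    c ℚ.* d ℚ.* F u ℚ.+ ⟪ F ∣ c ·P p ⟫
      ≡⟨ cong₂ ℚ._+_ (ℚP.*-assoc c d (F u)) (pairing-·P F c p) ⟩
    c ℚ.* (d ℚ.* F u) ℚ.+ c ℚ.* ⟪ F ∣ p ⟫
      ≡⟨ ℚP.*-distribˡ-+ c (d ℚ.* F u) ⟪ F ∣ p ⟫ ⟨
    c ℚ.* (d ℚ.* F u ℚ.+ ⟪ F ∣ p ⟫)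
      ∎

  pairing-difference : ∀ F p q → ⟪ F ∣ p +P (-P q) ⟫ ≡ ⟪ F ∣ p ⟫ ℚ.- ⟪ F ∣ q ⟫
  pairing-difference F p q = begin
    ⟪ F ∣ p ++ -P q ⟫
      ≡⟨ pairing-++ F p (-P q) ⟩
    ⟪ F ∣ p ⟫ ℚ.+ ⟪ F ∣ -P q ⟫
      ≡⟨ cong (⟪ F ∣ p ⟫ ℚ.+_) (pairing-·P F (ℚ.- 1ℚ) q) ⟩
    ⟪ F ∣ p ⟫ ℚ.+ ℚ.- 1ℚ ℚ.* ⟪ F ∣ q ⟫
      ≡⟨ cong (⟪ F ∣ p ⟫ ℚ.+_) (ℚ-ring.-1*x≈-x ⟪ F ∣ q ⟫) ⟩
    ⟪ F ∣ p ⟫ ℚ.- ⟪ F ∣ q ⟫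
      ∎

  pairing-word : ∀ F u → ⟪ F ∣ word u ⟫ ≡ F u
  pairing-word F u = trans (ℚP.+-identityʳ (1ℚ ℚ.* F u)) (ℚP.*-identityˡ (F u))

  pairing-consP : ∀ F x p → ⟪ F ∣ consP x p ⟫ ≡ ⟪ (λ u → F (x ∷ u)) ∣ p ⟫
  pairing-consP F x [] = refl
  pairing-consP F x ((c , u) ∷ p) = cong (c ℚ.* F (x ∷ u) ℚ.+_) (pairing-consP F x p)

  pairing-τP : ∀ F j p → ⟪ F ∣ τP j p ⟫ ≡ ⟪ (λ u → F (τ j u)) ∣ p ⟫
  pairing-τP F j [] = refl
  pairing-τP F j ((c , u) ∷ p) = cong (c ℚ.* F (τ j u) ℚ.+_) (pairing-τP F j p)

  pairing-concatMap : ∀ F f G p → (∀ c u → ⟪ F ∣ f (c , u) ⟫ ≡ c ℚ.* G u) →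
                      ⟪ F ∣ concatMap f p ⟫ ≡ ⟪ G ∣ p ⟫
  pairing-concatMap F f G [] _ = refl
  pairing-concatMap F f G ((c , u) ∷ p) f≗cG =
    trans (pairing-++ F (f (c , u)) (concatMap f p)) (cong₂ ℚ._+_ (f≗cG c u) (pairing-concatMap F f G p f≗cG))

  pairing-const-0 : ∀ p → ⟪ (λ _ → 0ℚ) ∣ p ⟫ ≡ 0ℚ
  pairing-const-0 [] = refl
  pairing-const-0 ((c , u) ∷ p) = trans (cong₂ ℚ._+_ (ℚP.*-zeroʳ c) (pairing-const-0 p)) (ℚP.+-identityˡ 0ℚ)

  pairing-+-pointwise : ∀ F G p → ⟪ (λ u → F u ℚ.+ G u) ∣ p ⟫ ≡ ⟪ F ∣ p ⟫ ℚ.+ ⟪ G ∣ p ⟫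
  pairing-+-pointwise F G [] = sym (ℚP.+-identityˡ 0ℚ)
  pairing-+-pointwise F G ((c , u) ∷ p) =
    trans (cong₂ ℚ._+_ (ℚP.*-distribˡ-+ c (F u) (G u)) (pairing-+-pointwise F G p))
          (ℚ+.interchange (c ℚ.* F u) (c ℚ.* G u) ⟪ F ∣ p ⟫ ⟪ G ∣ p ⟫)

  pairing-scale-pointwise : ∀ k F p → ⟪ (λ u → k ℚ.* F u) ∣ p ⟫ ≡ k ℚ.* ⟪ F ∣ p ⟫
  pairing-scale-pointwise k F [] = sym (ℚP.*-zeroʳ k)
  pairing-scale-pointwise k F ((c , u) ∷ p) = begin
    c ℚ.* (k ℚ.* F u) ℚ.+ ⟪ (λ u → k ℚ.* F u) ∣ p ⟫
      ≡⟨ cong₂ ℚ._+_ (sym (ℚP.*-assoc c k (F u))) (pairing-scale-pointwise k F p) ⟩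
    c ℚ.* k ℚ.* F u ℚ.+ k ℚ.* ⟪ F ∣ p ⟫
      ≡⟨ cong (λ a → a ℚ.* F u ℚ.+ k ℚ.* ⟪ F ∣ p ⟫) (ℚP.*-comm c k) ⟩
    k ℚ.* c ℚ.* F u ℚ.+ k ℚ.* ⟪ F ∣ p ⟫
      ≡⟨ cong (ℚ._+ k ℚ.* ⟪ F ∣ p ⟫) (ℚP.*-assoc k c (F u)) ⟩
    k ℚ.* (c ℚ.* F u) ℚ.+ k ℚ.* ⟪ F ∣ p ⟫
      ≡⟨ ℚP.*-distribˡ-+ k (c ℚ.* F u) ⟪ F ∣ p ⟫ ⟨
    k ℚ.* (c ℚ.* F u ℚ.+ ⟪ F ∣ p ⟫)
      ∎

  ⟪_∣_⊗_⟫ : (Word → Word → ℚ) → Poly → Poly → ℚ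
  ⟪ G ∣ p ⊗ q ⟫ = ⟪ (λ u → ⟪ G u ∣ q ⟫) ∣ p ⟫

  ⊗-cong : ∀ {G H} p q → (∀ u v → G u v ≡ H u v) → ⟪ G ∣ p ⊗ q ⟫ ≡ ⟪ H ∣ p ⊗ q ⟫
  ⊗-cong p q G≗H = pairing-cong p (λ u → pairing-cong q (G≗H u))

  ⊗-+ : ∀ G H p q →
        ⟪ (λ u v → G u v ℚ.+ H u v) ∣ p ⊗ q ⟫ ≡ ⟪ G ∣ p ⊗ q ⟫ ℚ.+ ⟪ H ∣ p ⊗ q ⟫
  ⊗-+ G H p q =
    trans (pairing-cong p (λ u → pairing-+-pointwise (G u) (H u) q))
          (pairing-+-pointwise (λ u → ⟪ G u ∣ q ⟫) (λ u → ⟪ H u ∣ q ⟫) p)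

  ⊗-swap : ∀ G p q → ⟪ G ∣ p ⊗ q ⟫ ≡ ⟪ flip G ∣ q ⊗ p ⟫
  ⊗-swap G [] q = sym (pairing-const-0 q)
  ⊗-swap G ((c , u) ∷ p) q = begin
    c ℚ.* ⟪ G u ∣ q ⟫ ℚ.+ ⟪ G ∣ p ⊗ q ⟫
      ≡⟨ cong₂ ℚ._+_ (sym (pairing-scale-pointwise c (G u) q)) (⊗-swap G p q) ⟩
    ⟪ (λ v → c ℚ.* G u v) ∣ q ⟫ ℚ.+ ⟪ flip G ∣ q ⊗ p ⟫
      ≡⟨ pairing-+-pointwise (λ v → c ℚ.* G u v) (λ v → ⟪ flip G v ∣ p ⟫) q ⟨
    ⟪ (λ v → c ℚ.* G u v ℚ.+ ⟪ flip G v ∣ p ⟫) ∣ q ⟫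
      ∎

  pairing-* : ∀ F p q → ⟪ F ∣ p * q ⟫ ≡ ⟪ (λ u v → ⟪ F ∣ stuffleW u v ⟫) ∣ p ⊗ q ⟫
  pairing-* F p q = pairing-concatMap F _ _ p λ c u →
    trans (pairing-concatMap F _ (λ v → c ℚ.* ⟪ F ∣ stuffleW u v ⟫) q (λ d v → begin
             ⟪ F ∣ (c ℚ.* d) ·P stuffleW u v ⟫
               ≡⟨ pairing-·P F (c ℚ.* d) (stuffleW u v) ⟩
             c ℚ.* d ℚ.* ⟪ F ∣ stuffleW u v ⟫
               ≡⟨ cong (ℚ._* ⟪ F ∣ stuffleW u v ⟫) (ℚP.*-comm c d) ⟩
             d ℚ.* c ℚ.* ⟪ F ∣ stuffleW u v ⟫
               ≡⟨ ℚP.*-assoc d c ⟪ F ∣ stuffleW u v ⟫ ⟩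
             d ℚ.* (c ℚ.* ⟪ F ∣ stuffleW u v ⟫)
               ∎))
          (pairing-scale-pointwise c (λ v → ⟪ F ∣ stuffleW u v ⟫) q)

  infix 4 _≋_
  record _≋_ (p q : Poly) : Set where
    constructor mk≋
    field pairing-≡ : ∀ F → ⟪ F ∣ p ⟫ ≡ ⟪ F ∣ q ⟫
  open _≋_ public

  indicator : Word → Word → ℚ
  indicator w u with u ≟W w
  ... | yes _ = 1ℚ
  ... | no _  = 0ℚ

  indicator-≢ : ∀ {v w} → ¬ w ≡ v → indicator v w ≡ 0ℚ
  indicator-≢ {v} {w} w≢v with w ≟W v
  ... | yes w≡v = ⊥-elim (w≢v w≡v)
  ... | no _    = refl

  coeff-pairing : ∀ p w → coeff p w ≡ ⟪ indicator w ∣ p ⟫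
  coeff-pairing [] w = refl
  coeff-pairing ((c , u) ∷ p) w with u ≟W w
  ... | yes _ = cong₂ ℚ._+_ (sym (ℚP.*-identityʳ c)) (coeff-pairing p w)
  ... | no _  = trans (coeff-pairing p w)
                      (sym (trans (cong (ℚ._+ ⟪ indicator w ∣ p ⟫) (ℚP.*-zeroʳ c)) (ℚP.+-identityˡ _)))

  ≋⇒≈ : ∀ {p q} → p ≋ q → p ≈ q
  ≋⇒≈ {p} {q} p≋q w = begin
    coeff p w            ≡⟨ coeff-pairing p w ⟩
    ⟪ indicator w ∣ p ⟫  ≡⟨ pairing-≡ p≋q (indicator w) ⟩
    ⟪ indicator w ∣ q ⟫  ≡⟨ coeff-pairing q w ⟨
    coeff q w            ∎

  without : Word → Poly → Poly
  without w [] = []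
  without w ((c , u) ∷ p) with u ≟W w
  ... | yes _ = without w p
  ... | no _  = (c , u) ∷ without w p

  without-head : ∀ c u p → without u ((c , u) ∷ p) ≡ without u p
  without-head c u p with u ≟W u
  ... | yes _  = refl
  ... | no u≢u = ⊥-elim (u≢u refl)

  length-without : ∀ w p → length (without w p) ≤ length p
  length-without w [] = z≤n
  length-without w ((c , u) ∷ p) with u ≟W w
  ... | yes _ = ℕP.m≤n⇒m≤1+n (length-without w p)
  ... | no _  = s≤s (length-without w p)

  pairing-without : ∀ F w p → ⟪ F ∣ p ⟫ ≡ coeff p w ℚ.* F w ℚ.+ ⟪ F ∣ without w p ⟫
  pairing-without F w [] = sym (trans (cong (ℚ._+ 0ℚ) (ℚP.*-zeroˡ (F w))) (ℚP.+-identityˡ 0ℚ))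
  pairing-without F w ((c , u) ∷ p) with u ≟W w
  ... | yes refl = begin
    c ℚ.* F u ℚ.+ ⟪ F ∣ p ⟫
      ≡⟨ cong (c ℚ.* F u ℚ.+_) (pairing-without F u p) ⟩
    c ℚ.* F u ℚ.+ (coeff p u ℚ.* F u ℚ.+ ⟪ F ∣ without u p ⟫)
      ≡⟨ ℚP.+-assoc (c ℚ.* F u) (coeff p u ℚ.* F u) ⟪ F ∣ without u p ⟫ ⟨
    c ℚ.* F u ℚ.+ coeff p u ℚ.* F u ℚ.+ ⟪ F ∣ without u p ⟫
      ≡⟨ cong (ℚ._+ ⟪ F ∣ without u p ⟫) (ℚP.*-distribʳ-+ (F u) c (coeff p u)) ⟨
    (c ℚ.+ coeff p u) ℚ.* F u ℚ.+ ⟪ F ∣ without u p ⟫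
      ∎
  ... | no _ = begin
    c ℚ.* F u ℚ.+ ⟪ F ∣ p ⟫
      ≡⟨ cong (c ℚ.* F u ℚ.+_) (pairing-without F w p) ⟩
    c ℚ.* F u ℚ.+ (coeff p w ℚ.* F w ℚ.+ ⟪ F ∣ without w p ⟫)
      ≡⟨ ℚ+.x∙yz≈y∙xz (c ℚ.* F u) (coeff p w ℚ.* F w) ⟪ F ∣ without w p ⟫ ⟩
    coeff p w ℚ.* F w ℚ.+ (c ℚ.* F u ℚ.+ ⟪ F ∣ without w p ⟫)
      ∎

  coeff-without-≢ : ∀ {v w} p → ¬ w ≡ v → coeff (without w p) v ≡ coeff p v
  coeff-without-≢ {v} {w} p w≢v = sym (begin
    coeff p v
      ≡⟨ coeff-pairing p v ⟩
    ⟪ indicator v ∣ p ⟫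
      ≡⟨ pairing-without (indicator v) w p ⟩
    coeff p w ℚ.* indicator v w ℚ.+ rest
      ≡⟨ cong (λ a → coeff p w ℚ.* a ℚ.+ rest) (indicator-≢ w≢v) ⟩
    coeff p w ℚ.* 0ℚ ℚ.+ rest
      ≡⟨ trans (cong (ℚ._+ rest) (ℚP.*-zeroʳ (coeff p w))) (ℚP.+-identityˡ rest) ⟩
    rest
      ≡⟨ coeff-pairing (without w p) v ⟨
    coeff (without w p) v
      ∎)
    where
    rest = ⟪ indicator v ∣ without w p ⟫

  coeff-without-≡ : ∀ w p → coeff (without w p) w ≡ 0ℚ
  coeff-without-≡ w [] = refl
  coeff-without-≡ w ((c , u) ∷ p) with u ≟W w
  ... | yes _ = coeff-without-≡ w p
  ... | no u≢w with u ≟W w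
  ...   | yes u≡w = ⊥-elim (u≢w u≡w)
  ...   | no _    = coeff-without-≡ w p

  _VanishesOn_ : (Word → ℚ) → Poly → Set
  F VanishesOn p = ∀ w → coeff p w ≡ 0ℚ ⊎ F w ≡ 0ℚ

  without-vanishes : ∀ {F} w p → F VanishesOn p → F VanishesOn without w p
  without-vanishes w p vanish v with w ≟W v
  ... | yes refl = inj₁ (coeff-without-≡ w p)
  ... | no w≢v   = Sum.map₁ (trans (coeff-without-≢ p w≢v)) (vanish v)

  -- Peel off the distinct words w of p one at a time; each contributes coeff p w · F w = 0.
  pairing-vanishes : ∀ F p → F VanishesOn p → ⟪ F ∣ p ⟫ ≡ 0ℚ
  pairing-vanishes F p = go (length p) p ℕP.≤-refl
    where
    go : ∀ n p → length p ≤ n → F VanishesOn p → ⟪ F ∣ p ⟫ ≡ 0ℚ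
    go _ [] _ _ = refl
    go (suc n) ((c , u) ∷ p) (s≤s |p|≤n) vanish = begin
      ⟪ F ∣ (c , u) ∷ p ⟫
        ≡⟨ pairing-without F u ((c , u) ∷ p) ⟩
      coeff ((c , u) ∷ p) u ℚ.* F u ℚ.+ ⟪ F ∣ without u ((c , u) ∷ p) ⟫
        ≡⟨ cong₂ ℚ._+_ (*-vanishes (coeff ((c , u) ∷ p) u) (F u) (vanish u)) rest≡0 ⟩
      0ℚ ℚ.+ 0ℚ
        ≡⟨ ℚP.+-identityˡ 0ℚ ⟩
      0ℚ
        ∎
      where
      rest≡0 : ⟪ F ∣ without u ((c , u) ∷ p) ⟫ ≡ 0ℚ
      rest≡0 = go n (without u ((c , u) ∷ p))
                 (subst (λ q → length q ≤ n) (sym (without-head c u p))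
                        (ℕP.≤-trans (length-without u p) |p|≤n))
                 (without-vanishes u ((c , u) ∷ p) vanish)

  ≈⇒≋ : ∀ {p q} → p ≈ q → p ≋ q
  ≈⇒≋ {p} {q} p≈q = mk≋ λ F → ℚ-group.x∙y⁻¹≈ε⇒x≈y ⟪ F ∣ p ⟫ ⟪ F ∣ q ⟫
    (trans (sym (pairing-difference F p q)) (pairing-vanishes F (p +P (-P q)) (inj₁ ∘ p-q≈0)))
    where
    p-q≈0 : (p +P (-P q)) ≈ 0P
    p-q≈0 w = begin
      coeff (p +P (-P q)) w
        ≡⟨ coeff-pairing (p +P (-P q)) w ⟩
      ⟪ indicator w ∣ p +P (-P q) ⟫
        ≡⟨ pairing-difference (indicator w) p q ⟩
      ⟪ indicator w ∣ p ⟫ ℚ.- ⟪ indicator w ∣ q ⟫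
        ≡⟨ cong₂ ℚ._-_ (coeff-pairing p w) (coeff-pairing q w) ⟨
      coeff p w ℚ.- coeff q w
        ≡⟨ cong (ℚ._- coeff q w) (p≈q w) ⟩
      coeff q w ℚ.- coeff q w
        ≡⟨ ℚP.+-inverseʳ (coeff q w) ⟩
      0ℚ
        ∎

  ≋-refl : ∀ {p} → p ≋ p
  ≋-refl = mk≋ λ F → refl

  ≋-sym : ∀ {p q} → p ≋ q → q ≋ p
  ≋-sym p≋q = mk≋ λ F → sym (pairing-≡ p≋q F)

  ≋-trans : ∀ {p q r} → p ≋ q → q ≋ r → p ≋ r
  ≋-trans p≋q q≋r = mk≋ λ F → trans (pairing-≡ p≋q F) (pairing-≡ q≋r F)

  ≋-isEquivalence : IsEquivalence _≋_
  ≋-isEquivalence = record { refl = ≋-refl ; sym = ≋-sym ; trans = ≋-trans }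

  ≋-setoid : Setoid 0ℓ 0ℓ
  ≋-setoid = record { isEquivalence = ≋-isEquivalence }

  ≡⇒≋ : ∀ {p q} → p ≡ q → p ≋ q
  ≡⇒≋ p≡q = mk≋ λ F → cong ⟪ F ∣_⟫ p≡q

  ++-cong : ∀ {p p′ q q′} → p ≋ p′ → q ≋ q′ → p ++ q ≋ p′ ++ q′
  ++-cong {p} {p′} {q} {q′} p≋p′ q≋q′ = mk≋ λ F → begin
    ⟪ F ∣ p ++ q ⟫             ≡⟨ pairing-++ F p q ⟩
    ⟪ F ∣ p ⟫ ℚ.+ ⟪ F ∣ q ⟫    ≡⟨ cong₂ ℚ._+_ (pairing-≡ p≋p′ F) (pairing-≡ q≋q′ F) ⟩
    ⟪ F ∣ p′ ⟫ ℚ.+ ⟪ F ∣ q′ ⟫  ≡⟨ pairing-++ F p′ q′ ⟨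
    ⟪ F ∣ p′ ++ q′ ⟫           ∎

  ++-comm : ∀ p q → p ++ q ≋ q ++ p
  ++-comm p q = mk≋ λ F → begin
    ⟪ F ∣ p ++ q ⟫           ≡⟨ pairing-++ F p q ⟩
    ⟪ F ∣ p ⟫ ℚ.+ ⟪ F ∣ q ⟫  ≡⟨ ℚP.+-comm ⟪ F ∣ p ⟫ ⟪ F ∣ q ⟫ ⟩
    ⟪ F ∣ q ⟫ ℚ.+ ⟪ F ∣ p ⟫  ≡⟨ pairing-++ F q p ⟨
    ⟪ F ∣ q ++ p ⟫           ∎

  ++-isCommutativeMonoid : IsCommutativeMonoid _≋_ _++_ []
  ++-isCommutativeMonoid = record
    { isMonoid = record
      { isSemigroup = record
        { isMagma = record { isEquivalence = ≋-isEquivalence ; ∙-cong = ++-cong }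
        ; assoc   = λ p q r → ≡⇒≋ (ListP.++-assoc p q r)
        }
      ; identity = (λ p → ≋-refl) , (λ p → ≡⇒≋ (ListP.++-identityʳ p))
      }
    ; comm = ++-comm
    }

  ++-commutativeMonoid : CommutativeMonoid 0ℓ 0ℓ
  ++-commutativeMonoid = record { isCommutativeMonoid = ++-isCommutativeMonoid }

  module _ where
    open CommutativeMonoidSolver ++-commutativeMonoid using (solve; _⊜_) renaming (_⊕_ to _⊞_)

    ++-swap₁₂ : ∀ a b c → a ++ b ++ c ≋ b ++ a ++ c
    ++-swap₁₂ = solve 3 (λ a b c → a ⊞ b ⊞ c ⊜ b ⊞ a ⊞ c) ≋-refl

    regroupˡ : ∀ a₁ a₂ a₃ b₁ b₂ b₃ c₁ c₂ c₃ →
               (a₁ ++ a₂ ++ a₃) ++ (b₁ ++ b₂ ++ b₃) ++ (c₁ ++ c₂ ++ c₃)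
                 ≋ a₁ ++ b₁ ++ (a₂ ++ b₂ ++ c₂) ++ c₁ ++ a₃ ++ b₃ ++ c₃
    regroupˡ = solve 9 (λ a₁ a₂ a₃ b₁ b₂ b₃ c₁ c₂ c₃ →
                 (a₁ ⊞ a₂ ⊞ a₃) ⊞ (b₁ ⊞ b₂ ⊞ b₃) ⊞ (c₁ ⊞ c₂ ⊞ c₃)
                   ⊜ a₁ ⊞ b₁ ⊞ (a₂ ⊞ b₂ ⊞ c₂) ⊞ c₁ ⊞ a₃ ⊞ b₃ ⊞ c₃) ≋-refl

    regroupʳ : ∀ a₁ a₂ a₃ b₁ b₂ b₃ c₁ c₂ c₃ →
               (a₁ ++ a₂ ++ a₃) ++ (b₁ ++ b₂ ++ b₃) ++ (c₁ ++ c₂ ++ c₃)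
                 ≋ (a₁ ++ b₁ ++ c₁) ++ a₂ ++ b₂ ++ a₃ ++ b₃ ++ c₂ ++ c₃
    regroupʳ = solve 9 (λ a₁ a₂ a₃ b₁ b₂ b₃ c₁ c₂ c₃ →
                 (a₁ ⊞ a₂ ⊞ a₃) ⊞ (b₁ ⊞ b₂ ⊞ b₃) ⊞ (c₁ ⊞ c₂ ⊞ c₃)
                   ⊜ (a₁ ⊞ b₁ ⊞ c₁) ⊞ a₂ ⊞ b₂ ⊞ a₃ ⊞ b₃ ⊞ c₂ ⊞ c₃) ≋-refl

  ·P-cong : ∀ c {p q} → p ≋ q → c ·P p ≋ c ·P q
  ·P-cong c {p} {q} p≋q = mk≋ λ F → begin
    ⟪ F ∣ c ·P p ⟫   ≡⟨ pairing-·P F c p ⟩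
    c ℚ.* ⟪ F ∣ p ⟫  ≡⟨ cong (c ℚ.*_) (pairing-≡ p≋q F) ⟩
    c ℚ.* ⟪ F ∣ q ⟫  ≡⟨ pairing-·P F c q ⟨
    ⟪ F ∣ c ·P q ⟫   ∎

  -P-inverseʳ : ∀ p → p +P (-P p) ≋ 0P
  -P-inverseʳ p = mk≋ λ F → trans (pairing-difference F p p) (ℚP.+-inverseʳ ⟪ F ∣ p ⟫)

  pairing-word-*-word : ∀ F u v → ⟪ F ∣ word u * word v ⟫ ≡ ⟪ F ∣ stuffleW u v ⟫
  pairing-word-*-word F u v =
    trans (pairing-* F (word u) (word v))
          (trans (pairing-word (λ u → ⟪ (λ v → ⟪ F ∣ stuffleW u v ⟫) ∣ word v ⟫) u)
                 (pairing-word (λ v → ⟪ F ∣ stuffleW u v ⟫) v))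

  pairing-*-linearˡ : ∀ F p q → ⟪ F ∣ p * q ⟫ ≡ ⟪ (λ u → ⟪ F ∣ word u * q ⟫) ∣ p ⟫
  pairing-*-linearˡ F p q = trans (pairing-* F p q) (pairing-cong p λ u →
    sym (trans (pairing-* F (word u) q) (pairing-word (λ u → ⟪ (λ v → ⟪ F ∣ stuffleW u v ⟫) ∣ q ⟫) u)))

  pairing-*-linearʳ : ∀ F p q → ⟪ F ∣ p * q ⟫ ≡ ⟪ (λ v → ⟪ F ∣ p * word v ⟫) ∣ q ⟫
  pairing-*-linearʳ F p q = trans (pairing-* F p q) (trans (⊗-swap _ p q) (pairing-cong q λ v →
    sym (trans (pairing-* F p (word v))
               (pairing-cong p (λ u → pairing-word (λ v → ⟪ F ∣ stuffleW u v ⟫) v)))))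

  pairing-*-basis : ∀ F p q → ⟪ F ∣ p * q ⟫ ≡ ⟪ (λ u v → ⟪ F ∣ word u * word v ⟫) ∣ p ⊗ q ⟫
  pairing-*-basis F p q = trans (pairing-*-linearˡ F p q) (pairing-cong p (λ u → pairing-*-linearʳ F (word u) q))

  pairing-[*]*-basis : ∀ F p q r →
    ⟪ F ∣ (p * q) * r ⟫
      ≡ ⟪ (λ u → ⟪ (λ v → ⟪ (λ w → ⟪ F ∣ (word u * word v) * word w ⟫) ∣ r ⟫) ∣ q ⟫) ∣ p ⟫
  pairing-[*]*-basis F p q r =
    trans (pairing-*-linearˡ F (p * q) r) (trans (pairing-*-basis _ p q) (⊗-cong p q λ u v →
      trans (sym (pairing-*-linearˡ F (word u * word v) r)) (pairing-*-linearʳ F (word u * word v) r)))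

  pairing-*[*]-basis : ∀ F p q r →
    ⟪ F ∣ p * (q * r) ⟫
      ≡ ⟪ (λ u → ⟪ (λ v → ⟪ (λ w → ⟪ F ∣ word u * (word v * word w) ⟫) ∣ r ⟫) ∣ q ⟫) ∣ p ⟫
  pairing-*[*]-basis F p q r = trans (pairing-*-linearˡ F p (q * r)) (pairing-cong p λ u →
    trans (pairing-*-linearʳ F (word u) (q * r)) (trans (pairing-*-basis _ q r) (⊗-cong q r λ v w →
      sym (pairing-*-linearʳ F (word u) (word v * word w)))))

  *-congˡ : ∀ {p p′} q → p ≋ p′ → p * q ≋ p′ * q
  *-congˡ {p} {p′} q p≋p′ = mk≋ λ F → begin
    ⟪ F ∣ p * q ⟫                        ≡⟨ pairing-*-linearˡ F p q ⟩
    ⟪ (λ u → ⟪ F ∣ word u * q ⟫) ∣ p ⟫   ≡⟨ pairing-≡ p≋p′ _ ⟩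
    ⟪ (λ u → ⟪ F ∣ word u * q ⟫) ∣ p′ ⟫  ≡⟨ pairing-*-linearˡ F p′ q ⟨
    ⟪ F ∣ p′ * q ⟫                       ∎

  *-congʳ : ∀ p {q q′} → q ≋ q′ → p * q ≋ p * q′
  *-congʳ p {q} {q′} q≋q′ = mk≋ λ F → begin
    ⟪ F ∣ p * q ⟫                        ≡⟨ pairing-*-linearʳ F p q ⟩
    ⟪ (λ v → ⟪ F ∣ p * word v ⟫) ∣ q ⟫   ≡⟨ pairing-≡ q≋q′ _ ⟩
    ⟪ (λ v → ⟪ F ∣ p * word v ⟫) ∣ q′ ⟫  ≡⟨ pairing-*-linearʳ F p q′ ⟨
    ⟪ F ∣ p * q′ ⟫                       ∎

  *-cong : ∀ {p p′ q q′} → p ≋ p′ → q ≋ q′ → p * q ≋ p′ * q′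
  *-cong {p′ = p′} {q = q} p≋p′ q≋q′ = ≋-trans (*-congˡ q p≋p′) (*-congʳ p′ q≋q′)

  *-distribʳ-++ : ∀ p q r → (p ++ q) * r ≋ p * r ++ q * r
  *-distribʳ-++ p q r = mk≋ λ F → begin
    ⟪ F ∣ (p ++ q) * r ⟫
      ≡⟨ pairing-*-linearˡ F (p ++ q) r ⟩
    ⟪ G F ∣ p ++ q ⟫
      ≡⟨ pairing-++ (G F) p q ⟩
    ⟪ G F ∣ p ⟫ ℚ.+ ⟪ G F ∣ q ⟫
      ≡⟨ cong₂ ℚ._+_ (pairing-*-linearˡ F p r) (pairing-*-linearˡ F q r) ⟨
    ⟪ F ∣ p * r ⟫ ℚ.+ ⟪ F ∣ q * r ⟫
      ≡⟨ pairing-++ F (p * r) (q * r) ⟨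
    ⟪ F ∣ p * r ++ q * r ⟫
      ∎
    where
    G : (Word → ℚ) → Word → ℚ
    G F u = ⟪ F ∣ word u * r ⟫

  *-distribˡ-++ : ∀ p q r → p * (q ++ r) ≋ p * q ++ p * r
  *-distribˡ-++ p q r = mk≋ λ F → begin
    ⟪ F ∣ p * (q ++ r) ⟫
      ≡⟨ pairing-*-linearʳ F p (q ++ r) ⟩
    ⟪ G F ∣ q ++ r ⟫
      ≡⟨ pairing-++ (G F) q r ⟩
    ⟪ G F ∣ q ⟫ ℚ.+ ⟪ G F ∣ r ⟫
      ≡⟨ cong₂ ℚ._+_ (pairing-*-linearʳ F p q) (pairing-*-linearʳ F p r) ⟨
    ⟪ F ∣ p * q ⟫ ℚ.+ ⟪ F ∣ p * r ⟫
      ≡⟨ pairing-++ F (p * q) (p * r) ⟨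
    ⟪ F ∣ p * q ++ p * r ⟫
      ∎
    where
    G : (Word → ℚ) → Word → ℚ
    G F v = ⟪ F ∣ p * word v ⟫

  *-distribʳ-++₃ : ∀ a b c r → (a ++ b ++ c) * r ≋ a * r ++ b * r ++ c * r
  *-distribʳ-++₃ a b c r = ≋-trans (*-distribʳ-++ a (b ++ c) r) (++-cong ≋-refl (*-distribʳ-++ b c r))

  *-distribˡ-++₃ : ∀ p a b c → p * (a ++ b ++ c) ≋ p * a ++ p * b ++ p * c
  *-distribˡ-++₃ p a b c = ≋-trans (*-distribˡ-++ p a (b ++ c)) (++-cong ≋-refl (*-distribˡ-++ p b c))

  stuffleW-[]ʳ : ∀ u → stuffleW u [] ≡ word u
  stuffleW-[]ʳ [] = refl
  stuffleW-[]ʳ (_ ∷ _) = refl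

  *-identityˡ : ∀ p → 1P * p ≋ p
  *-identityˡ p = mk≋ λ F → begin
    ⟪ F ∣ 1P * p ⟫
      ≡⟨ pairing-*-linearʳ F 1P p ⟩
    ⟪ (λ v → ⟪ F ∣ 1P * word v ⟫) ∣ p ⟫
      ≡⟨ pairing-cong p (λ v → trans (pairing-word-*-word F [] v) (pairing-word F v)) ⟩
    ⟪ F ∣ p ⟫
      ∎

  *-identityʳ : ∀ p → p * 1P ≋ p
  *-identityʳ p = mk≋ λ F → begin
    ⟪ F ∣ p * 1P ⟫                       ≡⟨ pairing-*-linearˡ F p 1P ⟩
    ⟪ (λ u → ⟪ F ∣ word u * 1P ⟫) ∣ p ⟫  ≡⟨ pairing-cong p (λ u → trans (pairing-word-*-word F u [])
                                              (trans (cong ⟪ F ∣_⟫ (stuffleW-[]ʳ u)) (pairing-word F u))) ⟩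
    ⟪ F ∣ p ⟫                            ∎

  *-scalarˡ : ∀ c p q → (c ·P p) * q ≋ c ·P (p * q)
  *-scalarˡ c p q = mk≋ λ F → begin
    ⟪ F ∣ (c ·P p) * q ⟫                      ≡⟨ pairing-*-linearˡ F (c ·P p) q ⟩
    ⟪ (λ u → ⟪ F ∣ word u * q ⟫) ∣ c ·P p ⟫   ≡⟨ pairing-·P _ c p ⟩
    c ℚ.* ⟪ (λ u → ⟪ F ∣ word u * q ⟫) ∣ p ⟫  ≡⟨ cong (c ℚ.*_) (pairing-*-linearˡ F p q) ⟨
    c ℚ.* ⟪ F ∣ p * q ⟫                       ≡⟨ pairing-·P F c (p * q) ⟨
    ⟪ F ∣ c ·P (p * q) ⟫                      ∎

  *-scalarʳ : ∀ c p q → p * (c ·P q) ≋ c ·P (p * q)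
  *-scalarʳ c p q = mk≋ λ F → begin
    ⟪ F ∣ p * (c ·P q) ⟫                      ≡⟨ pairing-*-linearʳ F p (c ·P q) ⟩
    ⟪ (λ v → ⟪ F ∣ p * word v ⟫) ∣ c ·P q ⟫   ≡⟨ pairing-·P _ c q ⟩
    c ℚ.* ⟪ (λ v → ⟪ F ∣ p * word v ⟫) ∣ q ⟫  ≡⟨ cong (c ℚ.*_) (pairing-*-linearʳ F p q) ⟨
    c ℚ.* ⟪ F ∣ p * q ⟫                       ≡⟨ pairing-·P F c (p * q) ⟨
    ⟪ F ∣ c ·P (p * q) ⟫                      ∎

  *-comm-on-words⇒*-comm : (∀ u v → word u * word v ≋ word v * word u) → ∀ p q → p * q ≋ q * p
  *-comm-on-words⇒*-comm word-*-comm p q = mk≋ λ F → begin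
    ⟪ F ∣ p * q ⟫
      ≡⟨ pairing-*-basis F p q ⟩
    ⟪ (λ u v → ⟪ F ∣ word u * word v ⟫) ∣ p ⊗ q ⟫
      ≡⟨ ⊗-swap _ p q ⟩
    ⟪ (λ v u → ⟪ F ∣ word u * word v ⟫) ∣ q ⊗ p ⟫
      ≡⟨ ⊗-cong q p (λ v u → pairing-≡ (word-*-comm u v) F) ⟩
    ⟪ (λ v u → ⟪ F ∣ word v * word u ⟫) ∣ q ⊗ p ⟫
      ≡⟨ pairing-*-basis F q p ⟨
    ⟪ F ∣ q * p ⟫
      ∎

  *-assoc-on-words⇒*-assoc : (∀ u v w → (word u * word v) * word w ≋ word u * (word v * word w)) →
                             ∀ p q r → (p * q) * r ≋ p * (q * r)
  *-assoc-on-words⇒*-assoc word-*-assoc p q r = mk≋ λ F → begin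
    ⟪ F ∣ (p * q) * r ⟫
      ≡⟨ pairing-[*]*-basis F p q r ⟩
    ⟪ (λ u → ⟪ (λ v → ⟪ (λ w → ⟪ F ∣ (word u * word v) * word w ⟫) ∣ r ⟫) ∣ q ⟫) ∣ p ⟫
      ≡⟨ pairing-cong p (λ u → pairing-cong q λ v → pairing-cong r λ w →
           pairing-≡ (word-*-assoc u v w) F) ⟩
    ⟪ (λ u → ⟪ (λ v → ⟪ (λ w → ⟪ F ∣ word u * (word v * word w) ⟫) ∣ r ⟫) ∣ q ⟫) ∣ p ⟫
      ≡⟨ pairing-*[*]-basis F p q r ⟨
    ⟪ F ∣ p * (q * r) ⟫
      ∎

module StuffleRecursion (N : ℕ) .{{_ : NonZero N}} where
  open Stuffle N
  open IndexShifts N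
  open Pairing N
  open ≡-Reasoning

  infixl 7 _◇_
  infixr 6 _◃_

  -- A letter (s , j) stands for y_{s+1,j}, hence the suc.
  _◇_ : Letter → Letter → Letter
  (s , j) ◇ (t , k) = (suc (s ℕ.+ t) , j ⊕ k)

  ◇-comm : ∀ x y → x ◇ y ≡ y ◇ x
  ◇-comm (s , j) (t , k) = cong₂ _,_ (cong suc (ℕP.+-comm s t)) (⊕-comm j k)

  ◇-assoc : ∀ x y z → (x ◇ y) ◇ z ≡ x ◇ (y ◇ z)
  ◇-assoc (s , j) (t , k) (r , l) =
    cong₂ _,_ (cong suc (trans (cong suc (ℕP.+-assoc s t r)) (sym (ℕP.+-suc s (t ℕ.+ r))))) (⊕-assoc j k l)

  _◃_ : Letter → Poly → Poly
  x ◃ p = consP x (τP (proj₂ x) p)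

  pairing-◃ : ∀ F x p → ⟪ F ∣ x ◃ p ⟫ ≡ ⟪ (λ u → F (x ∷ τ (proj₂ x) u)) ∣ p ⟫
  pairing-◃ F x p = trans (pairing-consP F x (τP (proj₂ x) p)) (pairing-τP (λ u → F (x ∷ u)) (proj₂ x) p)

  ⊗-◃ʳ : ∀ G y p q →
         ⟪ G ∣ p ⊗ y ◃ q ⟫ ≡ ⟪ (λ u v → G u (y ∷ τ (proj₂ y) v)) ∣ p ⊗ q ⟫
  ⊗-◃ʳ G y p q = pairing-cong p (λ u → pairing-◃ (G u) y q)

  pairing-◃-* : ∀ F x p q →
                ⟪ F ∣ x ◃ (p * q) ⟫ ≡ ⟪ (λ u v → ⟪ F ∣ x ◃ stuffleW u v ⟫) ∣ p ⊗ q ⟫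
  pairing-◃-* F x p q =
    trans (pairing-◃ F x (p * q))
          (trans (pairing-* _ p q) (⊗-cong p q (λ u v → sym (pairing-◃ F x (stuffleW u v)))))

  ◃-cong : ∀ x {p q} → p ≋ q → x ◃ p ≋ x ◃ q
  ◃-cong x {p} {q} p≋q = mk≋ λ F →
    trans (pairing-◃ F x p) (trans (pairing-≡ p≋q _) (sym (pairing-◃ F x q)))

  ◃-++ : ∀ x p q → x ◃ (p ++ q) ≡ x ◃ p ++ x ◃ q
  ◃-++ x p q = trans (cong (consP x) (ListP.map-++ _ p q)) (ListP.map-++ _ (τP (proj₂ x) p) (τP (proj₂ x) q))

  ◃-++₃ : ∀ x a b c → x ◃ (a ++ b ++ c) ≡ x ◃ a ++ x ◃ b ++ x ◃ c
  ◃-++₃ x a b c = trans (◃-++ x a (b ++ c)) (cong (x ◃ a ++_) (◃-++ x b c))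

  shrinkˡ : ∀ i (u v : Word) {b} →
            length u ℕ.+ suc (length v) ≤ b → length (τ i u) ℕ.+ suc (length v) ≤ b
  shrinkˡ i u v = ℕP.≤-trans (ℕP.≤-reflexive (cong (ℕ._+ suc (length v)) (length-τ i u)))

  shrinkʳ : ∀ i (u v : Word) {b} →
            length u ℕ.+ suc (length v) ≤ b → suc (length u) ℕ.+ length (τ i v) ≤ b
  shrinkʳ i u v = ℕP.≤-trans (ℕP.≤-reflexive (trans (cong (suc (length u) ℕ.+_) (length-τ i v))
                                                    (sym (ℕP.+-suc (length u) (length v)))))

  shrinkᵇ : ∀ i i′ (u v : Word) {b} →
            length u ℕ.+ suc (length v) ≤ b → length (τ i u) ℕ.+ length (τ i′ v) ≤ b
  shrinkᵇ i i′ u v = ℕP.≤-trans (ℕP.≤-trans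
    (ℕP.≤-reflexive (cong₂ ℕ._+_ (length-τ i u) (length-τ i′ v)))
    (ℕP.+-monoʳ-≤ (length u) (ℕP.n≤1+n (length v))))

  stuffleF-fuel : ∀ m n u v → length u ℕ.+ length v ≤ m → length u ℕ.+ length v ≤ n →
                  stuffleF m u v ≡ stuffleF n u v
  stuffleF-fuel _ _ [] v _ _ = refl
  stuffleF-fuel _ _ (_ ∷ _) [] _ _ = refl
  stuffleF-fuel zero _ (_ ∷ _) (_ ∷ _) () _
  stuffleF-fuel (suc _) zero (_ ∷ _) (_ ∷ _) _ ()
  stuffleF-fuel (suc m) (suc n) (x@(s , j) ∷ u) (y@(t , k) ∷ v) (s≤s ≤m) (s≤s ≤n) =
    cong₂ _++_ (cong (x ◃_) (stuffleF-fuel m n u′ (y ∷ v) (shrinkˡ _ u v ≤m) (shrinkˡ _ u v ≤n)))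
      (cong₂ _++_ (cong (y ◃_) (stuffleF-fuel m n (x ∷ u) v′ (shrinkʳ _ u v ≤m) (shrinkʳ _ u v ≤n)))
                  (cong (x ◇ y ◃_) (stuffleF-fuel m n u′ v′ (shrinkᵇ _ _ u v ≤m) (shrinkᵇ _ _ u v ≤n))))
    where
    u′ = τ (⊖ j) u
    v′ = τ (⊖ k) v

  stuffleF≡stuffleW : ∀ n u v → length u ℕ.+ length v ≤ n → stuffleF n u v ≡ stuffleW u v
  stuffleF≡stuffleW n u v ≤n = stuffleF-fuel n (length u ℕ.+ length v) u v ≤n ℕP.≤-refl

  stuffleW-∷ : ∀ s j u t k v →
    stuffleW ((s , j) ∷ u) ((t , k) ∷ v)
      ≡ (s , j) ◃ stuffleW (τ (⊖ j) u) ((t , k) ∷ v)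
        ++ (t , k) ◃ stuffleW ((s , j) ∷ u) (τ (⊖ k) v)
        ++ (s , j) ◇ (t , k) ◃ stuffleW (τ (⊖ j) u) (τ (⊖ k) v)
  stuffleW-∷ s j u t k v =
    cong₂ _++_ (cong (x ◃_) (stuffleF≡stuffleW n u′ (y ∷ v) (shrinkˡ _ u v ℕP.≤-refl)))
      (cong₂ _++_ (cong (y ◃_) (stuffleF≡stuffleW n (x ∷ u) v′ (shrinkʳ _ u v ℕP.≤-refl)))
                  (cong (x ◇ y ◃_) (stuffleF≡stuffleW n u′ v′ (shrinkᵇ _ _ u v ℕP.≤-refl))))
    where
    n = length u ℕ.+ suc (length v)
    x = (s , j)
    y = (t , k)
    u′ = τ (⊖ j) u
    v′ = τ (⊖ k) v

  stuffleW-◃ : ∀ x y U V →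
    stuffleW (x ∷ τ (proj₂ x) U) (y ∷ τ (proj₂ y) V)
      ≡ x ◃ stuffleW U (y ∷ τ (proj₂ y) V) ++ y ◃ stuffleW (x ∷ τ (proj₂ x) U) V ++ x ◇ y ◃ stuffleW U V
  stuffleW-◃ x@(s , j) y@(t , k) U V = begin
    stuffleW (x ∷ τ j U) (y ∷ τ k V)
      ≡⟨ stuffleW-∷ s j (τ j U) t k (τ k V) ⟩
    x ◃ stuffleW (τ (⊖ j) (τ j U)) (y ∷ τ k V) ++ y ◃ stuffleW (x ∷ τ j U) (τ (⊖ k) (τ k V))
      ++ x ◇ y ◃ stuffleW (τ (⊖ j) (τ j U)) (τ (⊖ k) (τ k V))
      ≡⟨ cong₂ (λ U′ V′ → x ◃ stuffleW U′ (y ∷ τ k V) ++ y ◃ stuffleW (x ∷ τ j U) V′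
                            ++ x ◇ y ◃ stuffleW U′ V′)
               (τ-⊖-τ j U) (τ-⊖-τ k V) ⟩
    x ◃ stuffleW U (y ∷ τ k V) ++ y ◃ stuffleW (x ∷ τ j U) V ++ x ◇ y ◃ stuffleW U V
      ∎

  ◃-*-◃ : ∀ x y p q →
          (x ◃ p) * (y ◃ q) ≋ x ◃ (p * (y ◃ q)) ++ y ◃ ((x ◃ p) * q) ++ x ◇ y ◃ (p * q)
  ◃-*-◃ x y p q = mk≋ λ F → begin
    ⟪ F ∣ (x ◃ p) * (y ◃ q) ⟫
      ≡⟨ trans (pairing-* F (x ◃ p) (y ◃ q)) (trans (⊗-◃ʳ (S F) y (x ◃ p) q) (pairing-◃ _ x p)) ⟩
    ⟪ (λ u v → ⟪ F ∣ stuffleW (x ∷ τ i u) (y ∷ τ k v) ⟫) ∣ p ⊗ q ⟫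
      ≡⟨ ⊗-cong p q (split F) ⟩
    ⟪ (λ u v → T₁ F u v ℚ.+ (T₂ F u v ℚ.+ T₃ F u v)) ∣ p ⊗ q ⟫
      ≡⟨ trans (⊗-+ (T₁ F) _ p q) (cong (⟪ T₁ F ∣ p ⊗ q ⟫ ℚ.+_) (⊗-+ (T₂ F) (T₃ F) p q)) ⟩
    ⟪ T₁ F ∣ p ⊗ q ⟫ ℚ.+ (⟪ T₂ F ∣ p ⊗ q ⟫ ℚ.+ ⟪ T₃ F ∣ p ⊗ q ⟫)
      ≡⟨ cong₂ ℚ._+_ (term₁ F) (cong₂ ℚ._+_ (term₂ F) (term₃ F)) ⟨
    ⟪ F ∣ x ◃ (p * (y ◃ q)) ⟫ ℚ.+ (⟪ F ∣ y ◃ ((x ◃ p) * q) ⟫ ℚ.+ ⟪ F ∣ x ◇ y ◃ (p * q) ⟫)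
      ≡⟨ pairing-++₃ F (x ◃ (p * (y ◃ q))) (y ◃ ((x ◃ p) * q)) (x ◇ y ◃ (p * q)) ⟨
    ⟪ F ∣ x ◃ (p * (y ◃ q)) ++ y ◃ ((x ◃ p) * q) ++ x ◇ y ◃ (p * q) ⟫
      ∎
    where
    i = proj₂ x
    k = proj₂ y
    S T₁ T₂ T₃ : (Word → ℚ) → Word → Word → ℚ
    S F u v = ⟪ F ∣ stuffleW u v ⟫
    T₁ F u v = ⟪ F ∣ x ◃ stuffleW u (y ∷ τ k v) ⟫
    T₂ F u v = ⟪ F ∣ y ◃ stuffleW (x ∷ τ i u) v ⟫
    T₃ F u v = ⟪ F ∣ x ◇ y ◃ stuffleW u v ⟫
    split : ∀ F u v →
            ⟪ F ∣ stuffleW (x ∷ τ i u) (y ∷ τ k v) ⟫ ≡ T₁ F u v ℚ.+ (T₂ F u v ℚ.+ T₃ F u v)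
    split F u v = trans (cong ⟪ F ∣_⟫ (stuffleW-◃ x y u v))
      (pairing-++₃ F (x ◃ stuffleW u (y ∷ τ k v)) (y ◃ stuffleW (x ∷ τ i u) v) (x ◇ y ◃ stuffleW u v))
    term₁ : ∀ F → ⟪ F ∣ x ◃ (p * (y ◃ q)) ⟫ ≡ ⟪ T₁ F ∣ p ⊗ q ⟫
    term₁ F = trans (pairing-◃-* F x p (y ◃ q)) (⊗-◃ʳ _ y p q)
    term₂ : ∀ F → ⟪ F ∣ y ◃ ((x ◃ p) * q) ⟫ ≡ ⟪ T₂ F ∣ p ⊗ q ⟫
    term₂ F = trans (pairing-◃-* F y (x ◃ p) q) (pairing-◃ _ x p)
    term₃ : ∀ F → ⟪ F ∣ x ◇ y ◃ (p * q) ⟫ ≡ ⟪ T₃ F ∣ p ⊗ q ⟫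
    term₃ F = pairing-◃-* F (x ◇ y) p q

module StuffleAlgebra (N : ℕ) .{{_ : NonZero N}} where
  open Stuffle N
  open IndexShifts N
  open Pairing N
  open StuffleRecursion N
  open SetoidReasoning ≋-setoid

  -- Indices are read relative to the preceding letter, so that ⟦ x ∷ d ⟧ = x ◃ ⟦ d ⟧ holds by definition.
  absolute : List Letter → Word
  absolute [] = []
  absolute (x ∷ d) = x ∷ τ (proj₂ x) (absolute d)

  ⟦_⟧ : List Letter → Poly
  ⟦ d ⟧ = word (absolute d)

  absolute-surjective : ∀ u → Σ (List Letter) (λ d → absolute d ≡ u)
  absolute-surjective u = go (length u) u refl
    where
    go : ∀ n u → length u ≡ n → Σ (List Letter) (λ d → absolute d ≡ u)
    go _ [] _ = [] , refl
    go (suc n) (x ∷ u) |xu|≡1+n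
      with go n (τ (⊖ (proj₂ x)) u) (trans (length-τ _ u) (ℕP.suc-injective |xu|≡1+n))
    ... | d , absolute-d≡ =
      x ∷ d , cong (x ∷_) (trans (cong (τ (proj₂ x)) absolute-d≡) (τ-τ-⊖ (proj₂ x) u))

  ⟦⟧-*-comm : ∀ d e → ⟦ d ⟧ * ⟦ e ⟧ ≋ ⟦ e ⟧ * ⟦ d ⟧
  ⟦⟧-*-comm [] e = ≋-trans (*-identityˡ ⟦ e ⟧) (≋-sym (*-identityʳ ⟦ e ⟧))
  ⟦⟧-*-comm d@(_ ∷ _) [] = ≋-trans (*-identityʳ ⟦ d ⟧) (≋-sym (*-identityˡ ⟦ d ⟧))
  ⟦⟧-*-comm (x ∷ d) (y ∷ e) = begin
    (x ◃ p) * (y ◃ q)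
      ≈⟨ ◃-*-◃ x y p q ⟩
    x ◃ (p * (y ◃ q)) ++ y ◃ ((x ◃ p) * q) ++ x ◇ y ◃ (p * q)
      ≈⟨ ++-cong (◃-cong x (⟦⟧-*-comm d (y ∷ e))) (++-cong (◃-cong y (⟦⟧-*-comm (x ∷ d) e)) last) ⟩
    x ◃ ((y ◃ q) * p) ++ y ◃ (q * (x ◃ p)) ++ y ◇ x ◃ (q * p)
      ≈⟨ ++-swap₁₂ (x ◃ ((y ◃ q) * p)) (y ◃ (q * (x ◃ p))) (y ◇ x ◃ (q * p)) ⟩
    y ◃ (q * (x ◃ p)) ++ x ◃ ((y ◃ q) * p) ++ y ◇ x ◃ (q * p)
      ≈⟨ ◃-*-◃ y x q p ⟨
    (y ◃ q) * (x ◃ p)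
      ∎
    where
    p = ⟦ d ⟧
    q = ⟦ e ⟧
    last : x ◇ y ◃ (p * q) ≋ y ◇ x ◃ (q * p)
    last = ≋-trans (◃-cong (x ◇ y) (⟦⟧-*-comm d e)) (≡⇒≋ (cong (_◃ (q * p)) (◇-comm x y)))

  firstLetterExpansion : (Poly → Poly → Poly → Poly) →
                         Letter → Letter → Letter → Poly → Poly → Poly → Poly
  firstLetterExpansion μ x y z p q r =
       x ◃ μ p Q R ++ y ◃ μ P q R ++ z ◃ μ P Q r
    ++ x ◇ y ◃ μ p q R ++ x ◇ z ◃ μ p Q r ++ y ◇ z ◃ μ P q r
    ++ x ◇ y ◇ z ◃ μ p q r
    where
    P = x ◃ p
    Q = y ◃ q
    R = z ◃ r

  ◃-*-◃-*-◃ˡ : ∀ x y z p q r →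
    ((x ◃ p) * (y ◃ q)) * (z ◃ r) ≋ firstLetterExpansion (λ a b c → (a * b) * c) x y z p q r
  ◃-*-◃-*-◃ˡ x y z p q r = begin
    (P * Q) * R
      ≈⟨ *-congˡ R (◃-*-◃ x y p q) ⟩
    (x ◃ (p * Q) ++ y ◃ (P * q) ++ x ◇ y ◃ (p * q)) * R
      ≈⟨ *-distribʳ-++₃ (x ◃ (p * Q)) (y ◃ (P * q)) (x ◇ y ◃ (p * q)) R ⟩
    (x ◃ (p * Q)) * R ++ (y ◃ (P * q)) * R ++ (x ◇ y ◃ (p * q)) * R
      ≈⟨ ++-cong (◃-*-◃ x z (p * Q) r) (++-cong (◃-*-◃ y z (P * q) r) (◃-*-◃ (x ◇ y) z (p * q) r)) ⟩
    (a₁ ++ a₂ ++ a₃) ++ (b₁ ++ b₂ ++ b₃) ++ (c₁ ++ c₂ ++ c₃)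
      ≈⟨ regroupˡ a₁ a₂ a₃ b₁ b₂ b₃ c₁ c₂ c₃ ⟩
    a₁ ++ b₁ ++ (a₂ ++ b₂ ++ c₂) ++ c₁ ++ a₃ ++ b₃ ++ c₃
      ≈⟨ ++-cong (≋-refl {a₁}) (++-cong (≋-refl {b₁})
           (++-cong z-terms (≋-refl {c₁ ++ a₃ ++ b₃ ++ c₃}))) ⟩
    firstLetterExpansion (λ a b c → (a * b) * c) x y z p q r
      ∎
    where
    P = x ◃ p
    Q = y ◃ q
    R = z ◃ r
    a₁ = x ◃ ((p * Q) * R)
    a₂ = z ◃ ((x ◃ (p * Q)) * r)
    a₃ = x ◇ z ◃ ((p * Q) * r)
    b₁ = y ◃ ((P * q) * R)
    b₂ = z ◃ ((y ◃ (P * q)) * r)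
    b₃ = y ◇ z ◃ ((P * q) * r)
    c₁ = x ◇ y ◃ ((p * q) * R)
    c₂ = z ◃ ((x ◇ y ◃ (p * q)) * r)
    c₃ = x ◇ y ◇ z ◃ ((p * q) * r)
    z-terms : a₂ ++ b₂ ++ c₂ ≋ z ◃ ((P * Q) * r)
    z-terms = begin
      a₂ ++ b₂ ++ c₂
        ≡⟨ ◃-++₃ z ((x ◃ (p * Q)) * r) ((y ◃ (P * q)) * r) ((x ◇ y ◃ (p * q)) * r) ⟨
      z ◃ ((x ◃ (p * Q)) * r ++ (y ◃ (P * q)) * r ++ (x ◇ y ◃ (p * q)) * r)
        ≈⟨ ◃-cong z (*-distribʳ-++₃ (x ◃ (p * Q)) (y ◃ (P * q)) (x ◇ y ◃ (p * q)) r) ⟨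
      z ◃ ((x ◃ (p * Q) ++ y ◃ (P * q) ++ x ◇ y ◃ (p * q)) * r)
        ≈⟨ ◃-cong z (*-congˡ r (◃-*-◃ x y p q)) ⟨
      z ◃ ((P * Q) * r)
        ∎

  ◃-*-◃-*-◃ʳ : ∀ x y z p q r →
    (x ◃ p) * ((y ◃ q) * (z ◃ r)) ≋ firstLetterExpansion (λ a b c → a * (b * c)) x y z p q r
  ◃-*-◃-*-◃ʳ x y z p q r = begin
    P * (Q * R)
      ≈⟨ *-congʳ P (◃-*-◃ y z q r) ⟩
    P * (y ◃ (q * R) ++ z ◃ (Q * r) ++ y ◇ z ◃ (q * r))
      ≈⟨ *-distribˡ-++₃ P (y ◃ (q * R)) (z ◃ (Q * r)) (y ◇ z ◃ (q * r)) ⟩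
    P * (y ◃ (q * R)) ++ P * (z ◃ (Q * r)) ++ P * (y ◇ z ◃ (q * r))
      ≈⟨ ++-cong (◃-*-◃ x y p (q * R)) (++-cong (◃-*-◃ x z p (Q * r)) (◃-*-◃ x (y ◇ z) p (q * r))) ⟩
    (a₁ ++ a₂ ++ a₃) ++ (b₁ ++ b₂ ++ b₃) ++ (c₁ ++ c₂ ++ c₃)
      ≈⟨ regroupʳ a₁ a₂ a₃ b₁ b₂ b₃ c₁ c₂ c₃ ⟩
    (a₁ ++ b₁ ++ c₁) ++ a₂ ++ b₂ ++ a₃ ++ b₃ ++ c₂ ++ c₃
      ≈⟨ ++-cong x-terms (++-cong (≋-refl {a₂}) (++-cong (≋-refl {b₂}) (++-cong (≋-refl {a₃})
           (++-cong (≋-refl {b₃}) (++-cong (≋-refl {c₂}) xyz-term))))) ⟩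
    firstLetterExpansion (λ a b c → a * (b * c)) x y z p q r
      ∎
    where
    P = x ◃ p
    Q = y ◃ q
    R = z ◃ r
    a₁ = x ◃ (p * (y ◃ (q * R)))
    a₂ = y ◃ (P * (q * R))
    a₃ = x ◇ y ◃ (p * (q * R))
    b₁ = x ◃ (p * (z ◃ (Q * r)))
    b₂ = z ◃ (P * (Q * r))
    b₃ = x ◇ z ◃ (p * (Q * r))
    c₁ = x ◃ (p * (y ◇ z ◃ (q * r)))
    c₂ = y ◇ z ◃ (P * (q * r))
    c₃ = x ◇ (y ◇ z) ◃ (p * (q * r))
    x-terms : a₁ ++ b₁ ++ c₁ ≋ x ◃ (p * (Q * R))
    x-terms = begin
      a₁ ++ b₁ ++ c₁
        ≡⟨ ◃-++₃ x (p * (y ◃ (q * R))) (p * (z ◃ (Q * r))) (p * (y ◇ z ◃ (q * r))) ⟨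
      x ◃ (p * (y ◃ (q * R)) ++ p * (z ◃ (Q * r)) ++ p * (y ◇ z ◃ (q * r)))
        ≈⟨ ◃-cong x (*-distribˡ-++₃ p (y ◃ (q * R)) (z ◃ (Q * r)) (y ◇ z ◃ (q * r))) ⟨
      x ◃ (p * (y ◃ (q * R) ++ z ◃ (Q * r) ++ y ◇ z ◃ (q * r)))
        ≈⟨ ◃-cong x (*-congʳ p (◃-*-◃ y z q r)) ⟨
      x ◃ (p * (Q * R))
        ∎
    xyz-term : c₃ ≋ x ◇ y ◇ z ◃ (p * (q * r))
    xyz-term = ≡⇒≋ (cong (_◃ (p * (q * r))) (sym (◇-assoc x y z)))

  ⟦⟧-*-assoc : ∀ d e f → (⟦ d ⟧ * ⟦ e ⟧) * ⟦ f ⟧ ≋ ⟦ d ⟧ * (⟦ e ⟧ * ⟦ f ⟧)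
  ⟦⟧-*-assoc [] e f =
    ≋-trans (*-congˡ ⟦ f ⟧ (*-identityˡ ⟦ e ⟧)) (≋-sym (*-identityˡ (⟦ e ⟧ * ⟦ f ⟧)))
  ⟦⟧-*-assoc d@(_ ∷ _) [] f =
    ≋-trans (*-congˡ ⟦ f ⟧ (*-identityʳ ⟦ d ⟧)) (≋-sym (*-congʳ ⟦ d ⟧ (*-identityˡ ⟦ f ⟧)))
  ⟦⟧-*-assoc d@(_ ∷ _) e@(_ ∷ _) [] =
    ≋-trans (*-identityʳ (⟦ d ⟧ * ⟦ e ⟧)) (≋-sym (*-congʳ ⟦ d ⟧ (*-identityʳ ⟦ e ⟧)))
  ⟦⟧-*-assoc (x ∷ d) (y ∷ e) (z ∷ f) = begin
    ((x ◃ p) * (y ◃ q)) * (z ◃ r)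
      ≈⟨ ◃-*-◃-*-◃ˡ x y z p q r ⟩
    firstLetterExpansion (λ a b c → (a * b) * c) x y z p q r
      ≈⟨ ++-cong (◃-cong x (⟦⟧-*-assoc d (y ∷ e) (z ∷ f)))
        (++-cong (◃-cong y (⟦⟧-*-assoc (x ∷ d) e (z ∷ f)))
        (++-cong (◃-cong z (⟦⟧-*-assoc (x ∷ d) (y ∷ e) f))
        (++-cong (◃-cong (x ◇ y) (⟦⟧-*-assoc d e (z ∷ f)))
        (++-cong (◃-cong (x ◇ z) (⟦⟧-*-assoc d (y ∷ e) f))
        (++-cong (◃-cong (y ◇ z) (⟦⟧-*-assoc (x ∷ d) e f))
                 (◃-cong (x ◇ y ◇ z) (⟦⟧-*-assoc d e f))))))) ⟩
    firstLetterExpansion (λ a b c → a * (b * c)) x y z p q r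
      ≈⟨ ◃-*-◃-*-◃ʳ x y z p q r ⟨
    (x ◃ p) * ((y ◃ q) * (z ◃ r))
      ∎
    where
    p = ⟦ d ⟧
    q = ⟦ e ⟧
    r = ⟦ f ⟧

  word-*-comm : ∀ u v → word u * word v ≋ word v * word u
  word-*-comm u v with absolute-surjective u | absolute-surjective v
  ... | d , refl | e , refl = ⟦⟧-*-comm d e

  word-*-assoc : ∀ u v w → (word u * word v) * word w ≋ word u * (word v * word w)
  word-*-assoc u v w with absolute-surjective u | absolute-surjective v | absolute-surjective w
  ... | d , refl | e , refl | f , refl = ⟦⟧-*-assoc d e f

  *-comm : ∀ p q → p * q ≋ q * p
  *-comm = *-comm-on-words⇒*-comm word-*-comm

  *-assoc : ∀ p q r → (p * q) * r ≋ p * (q * r)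
  *-assoc = *-assoc-on-words⇒*-assoc word-*-assoc

  ≈-isEquivalence : IsEquivalence _≈_
  ≈-isEquivalence = record
    { refl  = λ w → refl
    ; sym   = λ p≈q w → sym (p≈q w)
    ; trans = λ p≈q q≈r w → trans (p≈q w) (q≈r w)
    }

  isCommutativeRing : IsCommutativeRing _≈_ _+P_ _*_ -P_ 0P 1P
  isCommutativeRing = record
    { isRing = record
      { +-isAbelianGroup = record
        { isGroup = record
          { isMonoid = record
            { isSemigroup = record
              { isMagma = record
                { isEquivalence = ≈-isEquivalence
                ; ∙-cong = λ {p} {p′} {q} {q′} p≈p′ q≈q′ →
                    ≋⇒≈ (++-cong (≈⇒≋ {p} {p′} p≈p′) (≈⇒≋ {q} {q′} q≈q′))
                }
              ; assoc = λ p q r → ≋⇒≈ (≡⇒≋ (ListP.++-assoc p q r))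
              }
            ; identity = (λ p w → refl) , (λ p → ≋⇒≈ (≡⇒≋ (ListP.++-identityʳ p)))
            }
          ; inverse = (λ p → ≋⇒≈ (≋-trans (++-comm (-P p) p) (-P-inverseʳ p)))
                    , (λ p → ≋⇒≈ (-P-inverseʳ p))
          ; ⁻¹-cong = λ {p} {q} p≈q → ≋⇒≈ (·P-cong (ℚ.- 1ℚ) (≈⇒≋ {p} {q} p≈q))
          }
        ; comm = λ p q → ≋⇒≈ (++-comm p q)
        }
      ; *-cong = λ {p} {p′} {q} {q′} p≈p′ q≈q′ →
          ≋⇒≈ (*-cong (≈⇒≋ {p} {p′} p≈p′) (≈⇒≋ {q} {q′} q≈q′))
      ; *-assoc = λ p q r → ≋⇒≈ (*-assoc p q r)
      ; *-identity = (λ p → ≋⇒≈ (*-identityˡ p)) , (λ p → ≋⇒≈ (*-identityʳ p))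
      ; distrib = (λ p q r → ≋⇒≈ (*-distribˡ-++ p q r)) , (λ r p q → ≋⇒≈ (*-distribʳ-++ p q r))
      }
    ; *-comm = λ p q → ≋⇒≈ (*-comm p q)
    }

module StuffleGrading (N : ℕ) .{{_ : NonZero N}} where
  open Stuffle N
  open IndexShifts N
  open Pairing N
  open StuffleRecursion N
  open ≡-Reasoning

  AllOfWeight : ℕ → Poly → Set
  AllOfWeight k = All (λ m → weight (proj₂ m) ≡ k)

  ◃-allOfWeight : ∀ x {k k′} p →
                  AllOfWeight k p → letterWeight x ℕ.+ k ≡ k′ → AllOfWeight k′ (x ◃ p)
  ◃-allOfWeight x [] [] _ = []
  ◃-allOfWeight x ((c , u) ∷ p) (|u|≡k ∷ rest) refl =
    cong (letterWeight x ℕ.+_) (trans (weight-τ (proj₂ x) u) |u|≡k) ∷ ◃-allOfWeight x p rest refl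

  stuffleF-allOfWeight : ∀ n u v → AllOfWeight (weight u ℕ.+ weight v) (stuffleF n u v)
  stuffleF-allOfWeight _ [] v = refl ∷ []
  stuffleF-allOfWeight _ (_ ∷ u) [] = sym (ℕP.+-identityʳ _) ∷ []
  stuffleF-allOfWeight zero (_ ∷ _) (_ ∷ _) = []
  stuffleF-allOfWeight (suc n) (x@(s , j) ∷ u) (y@(t , k) ∷ v) =
    ++⁺ (◃-allOfWeight x _ (stuffleF-allOfWeight n u′ (y ∷ v)) weight₁)
        (++⁺ (◃-allOfWeight y _ (stuffleF-allOfWeight n (x ∷ u) v′) weight₂)
             (◃-allOfWeight (x ◇ y) _ (stuffleF-allOfWeight n u′ v′) weight₃))
    where
    u′ = τ (⊖ j) u
    v′ = τ (⊖ k) v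
    |u| = weight u
    |v| = weight v
    rearrange₂ : ∀ s t a b → suc t ℕ.+ (suc s ℕ.+ a ℕ.+ b) ≡ suc s ℕ.+ a ℕ.+ (suc t ℕ.+ b)
    rearrange₂ = solve-∀
    rearrange₃ : ∀ s t a b → suc (suc (s ℕ.+ t)) ℕ.+ (a ℕ.+ b) ≡ suc s ℕ.+ a ℕ.+ (suc t ℕ.+ b)
    rearrange₃ = solve-∀
    weight₁ : suc s ℕ.+ (weight u′ ℕ.+ (suc t ℕ.+ |v|)) ≡ suc s ℕ.+ |u| ℕ.+ (suc t ℕ.+ |v|)
    weight₁ rewrite weight-τ (⊖ j) u = sym (ℕP.+-assoc (suc s) |u| (suc t ℕ.+ |v|))
    weight₂ : suc t ℕ.+ (suc s ℕ.+ |u| ℕ.+ weight v′) ≡ suc s ℕ.+ |u| ℕ.+ (suc t ℕ.+ |v|)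
    weight₂ rewrite weight-τ (⊖ k) v = rearrange₂ s t |u| |v|
    weight₃ : suc (suc (s ℕ.+ t)) ℕ.+ (weight u′ ℕ.+ weight v′) ≡ suc s ℕ.+ |u| ℕ.+ (suc t ℕ.+ |v|)
    weight₃ rewrite weight-τ (⊖ j) u | weight-τ (⊖ k) v = rearrange₃ s t |u| |v|

  coeff-allOfWeight : ∀ {k} p w → AllOfWeight k p → ¬ weight w ≡ k → coeff p w ≡ 0ℚ
  coeff-allOfWeight [] w [] _ = refl
  coeff-allOfWeight ((c , u) ∷ p) w (|u|≡k ∷ rest) |w|≢k with u ≟W w
  ... | yes refl = ⊥-elim (|w|≢k |u|≡k)
  ... | no _     = coeff-allOfWeight p w rest |w|≢k

  homogeneous-vanishes : ∀ {k F} p →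
                         Homogeneous k p → (∀ u → weight u ≡ k → F u ≡ 0ℚ) → F VanishesOn p
  homogeneous-vanishes p hom F≡0 u with coeff p u ℚP.≟ 0ℚ
  ... | yes coeff≡0 = inj₁ coeff≡0
  ... | no  coeff≢0 = inj₂ (F≡0 u (hom u coeff≢0))

  *-homogeneous : ∀ m n p q → Homogeneous m p → Homogeneous n q → Homogeneous (m ℕ.+ n) (p * q)
  *-homogeneous m n p q hom-p hom-q w coeff≢0 with weight w ℕ.≟ m ℕ.+ n
  ... | yes |w|≡m+n = |w|≡m+n
  ... | no  |w|≢m+n = ⊥-elim (coeff≢0 (begin
    coeff (p * q) w
      ≡⟨ coeff-pairing (p * q) w ⟩
    ⟪ indicator w ∣ p * q ⟫
      ≡⟨ pairing-* (indicator w) p q ⟩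
    ⟪ (λ u v → ⟪ indicator w ∣ stuffleW u v ⟫) ∣ p ⊗ q ⟫
      ≡⟨ pairing-vanishes _ p (homogeneous-vanishes p hom-p row≡0) ⟩
    0ℚ
      ∎))
    where
    stuffleW-coeff≡0 : ∀ u v → ¬ weight w ≡ weight u ℕ.+ weight v →
                       ⟪ indicator w ∣ stuffleW u v ⟫ ≡ 0ℚ
    stuffleW-coeff≡0 u v |w|≢ = trans (sym (coeff-pairing (stuffleW u v) w))
                                      (coeff-allOfWeight (stuffleW u v) w (stuffleF-allOfWeight _ u v) |w|≢)
    row≡0 : ∀ u → weight u ≡ m → ⟪ (λ v → ⟪ indicator w ∣ stuffleW u v ⟫) ∣ q ⟫ ≡ 0ℚ
    row≡0 u |u|≡m = pairing-vanishes _ q (homogeneous-vanishes q hom-q λ v |v|≡n →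
      stuffleW-coeff≡0 u v (λ |w|≡ → |w|≢m+n (trans |w|≡ (cong₂ ℕ._+_ |u|≡m |v|≡n))))

  1P-homogeneous : Homogeneous 0 1P
  1P-homogeneous w coeff≢0 with [] ≟W w
  ... | yes refl = refl
  ... | no _     = ⊥-elim (coeff≢0 refl)

mainTheorem3 : (N : ℕ) .{{_ : NonZero N}} → Stuffle.IsCommGradedAlgebra N
mainTheorem3 N = record
  { isCommutativeRing = isCommutativeRing
  ; *-scalarˡ         = λ c p q → ≋⇒≈ (*-scalarˡ c p q)
  ; *-scalarʳ         = λ c p q → ≋⇒≈ (*-scalarʳ c p q)
  ; *-graded          = *-homogeneous
  ; 1-homogeneous     = 1P-homogeneous
  }
  where
  open Pairing N
  open StuffleAlgebra N
  open StuffleGrading N
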